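{- Let $Q$ be a spider web quiver with three concentric circles and let $n$ be the number of vertices on its middle circle, labeled $1,\dots,n$. Let $\tau=\mu_1\mu_2\cdots\mu_{n-2}\,s_{n-1,n}\,\mu_n\mu_{n-1}\cdots\mu_1$ (composition of operations, rightmost applied first), where $\mu_k$ is quiver mutation at vertex $k$ and $s_{n-1,n}$ transposes the vertices $n-1$ and $n$. Then $\tau(Q)=Q$.
   Context: A quiver is a directed graph with labeled vertices and no loops or 2-cycles. Quiver mutation $\mu_k$: for each pair of arrows $i\to k\to j$ add an arrow $i\to j$, reverse all arrows incident to $k$, then remove 2-cycles. A spider web quiver is constructed as follows: take three or more concentric circles; place at least 2 vertices on each circle; orient the edges of each circle counterclockwise; then add arrows between vertices on adjacent circles so that every face is oriented (a directed cycle), contains exactly two arrows between circles, and has at least 3 sides. With three circles, the vertices of the middle circle are labeled $1,\dots,n$ following the arrows around the circle. -}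

module Defs where

open import Data.Nat using (ℕ; zero; suc; _+_; _*_; _∸_; _≤_; _<?_)
open import Data.Fin using (Fin; zero; suc; toℕ; fromℕ; fromℕ<; inject₁; _<_)
import Data.Fin as Fin
open import Data.Sum using (_⊎_; inj₁; inj₂)
open import Data.Sum.Properties using (≡-dec)
open import Data.Product using (∃-syntax)
open import Data.List using (List; []; _∷_; allFin; map; reverse; foldl)
open import Data.Nat.ListAction using (sum)
open import Relation.Binary.PropositionalEquality using (_≡_; _≢_)
open import Relation.Binary.Definitions using (DecidableEquality)
open import Relation.Nullary using (does; yes; no)
open import Data.Bool using (if_then_else_; _∨_; _∧_)

-- A quiver on a vertex type V is given by its arrow counts:
-- Q i j = number of arrows i → j.
Quiver : Set → Set
Quiver V = V → V → ℕ

module _ {V : Set} (_≟_ : DecidableEquality V) where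

  -- Quiver mutation μ_k: for every path i → k → j add an arrow i → j
  -- (Q i k * Q k j new arrows), reverse all arrows incident to k, then
  -- remove 2-cycles (cancel arrows i → j against arrows j → i).
  mutate : V → Quiver V → Quiver V
  mutate k Q i j =
    if does (i ≟ k) ∨ does (j ≟ k)
    then Q j i
    else (Q i j + Q i k * Q k j) ∸ (Q j i + Q j k * Q k i)

  swapV : V → V → V → V
  swapV a b v = if does (v ≟ a) then b else (if does (v ≟ b) then a else v)

  transpose : V → V → Quiver V → Quiver V
  transpose a b Q i j = Q (swapV a b i) (swapV a b j)

  remove2cycles : Quiver V → Quiver V
  remove2cycles Q i j = Q i j ∸ Q j i

csuc : ∀ {k} → Fin k → Fin k
csuc {suc k} j with suc (toℕ j) <? suc k
... | yes p = fromℕ< p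
... | no _  = zero

-- f : Fin k → Fin s lists k points of a circle with s vertices in
-- counterclockwise cyclic order, going around the circle exactly once:
-- all cyclic steps f j → f (j+1) are increasing except one (the wrap-around).
CyclicallyIncreasing : ∀ {k s} → (Fin k → Fin s) → Set
CyclicallyIncreasing {k} f = ∃[ r ] (∀ (j : Fin k) → j ≢ r → f j < f (csuc j))

-- Planarity plus the conditions "every face
-- is oriented, has exactly two arrows between circles and at least 3 sides"
-- force the arrows between the circles to form a zigzag: there are k ≥ 2
-- touched vertices a 0, …, a (k-1) on the inner circle and b 0, …, b (k-1)
-- on the outer circle, both in counterclockwise cyclic order, and the arrows
-- between the circles are exactly  a j → b j  and  b (j+1) → a j  (mod k).
record Zigzag (s t : ℕ) : Set where
  field
    k     : ℕ
    2≤k   : 2 ≤ k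
    a     : Fin k → Fin s
    b     : Fin k → Fin t
    a-cyc : CyclicallyIncreasing a
    b-cyc : CyclicallyIncreasing b

-- A spider web quiver with three concentric circles; n = number of vertices
-- on the middle circle, whose vertices are Fin n (vertex j : Fin n carries
-- label toℕ j + 1, labels increasing along the arrows of the circle).
record SpiderWeb3 (n : ℕ) : Set where
  field
    p     : ℕ              -- vertices on the inner circle
    q     : ℕ              -- vertices on the outer circle
    2≤p   : 2 ≤ p
    2≤n   : 2 ≤ n
    2≤q   : 2 ≤ q
    inner : Zigzag p n
    outer : Zigzag n q

mutateSeq : ∀ {V} → DecidableEquality V → List V → Quiver V → Quiver V
mutateSeq _≟_ vs Q = foldl (λ R v → mutate _≟_ v R) Q vs

-- τ = μ_1 μ_2 ⋯ μ_{n-2} s_{n-1,n} μ_n μ_{n-1} ⋯ μ_1 (rightmost applied first)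
-- for a quiver whose vertices labelled 1, …, n are mid 0, …, mid (n-1)
-- (label of mid j is toℕ j + 1).  Only used for n ≥ 2.
tauSeq : ∀ {V} → DecidableEquality V → (n : ℕ) → (Fin n → V) → Quiver V → Quiver V
tauSeq _≟_ (suc (suc m)) mid Q =
  mutateSeq _≟_ (reverse (map (λ j → mid (inject₁ (inject₁ j))) (allFin m)))  -- μ_{n-2}, …, μ_1
    (transpose _≟_ (mid (inject₁ (fromℕ m))) (mid (fromℕ (suc m)))           -- s_{n-1,n}
      (mutateSeq _≟_ (map mid (allFin (suc (suc m)))) Q))
tauSeq _≟_ _ mid Q = Q

module _ {n : ℕ} (W : SpiderWeb3 n) where
  open SpiderWeb3 W

  -- vertices: inner circle, middle circle, outer circle
  Vtx : Set
  Vtx = Fin p ⊎ (Fin n ⊎ Fin q)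

  _≟V_ : DecidableEquality Vtx
  _≟V_ = ≡-dec Fin._≟_ (≡-dec Fin._≟_ Fin._≟_)

  inV : Fin p → Vtx
  inV = inj₁
  midV : Fin n → Vtx
  midV j = inj₂ (inj₁ j)
  outV : Fin q → Vtx
  outV j = inj₂ (inj₂ j)

  private
    δ : Vtx → Vtx → ℕ
    δ u v = if does (u ≟V v) then 1 else 0

    count : ∀ {k} → (Fin k → ℕ) → ℕ
    count {k} f = sum (map f (allFin k))

    -- arrows of the circles, oriented counterclockwise
    circleArrows : Vtx → Vtx → ℕ
    circleArrows (inj₁ i)        v = δ (inV (csuc i)) v
    circleArrows (inj₂ (inj₁ i)) v = δ (midV (csuc i)) v
    circleArrows (inj₂ (inj₂ i)) v = δ (outV (csuc i)) v

    zigzagArrows : ∀ {s t} → (Fin s → Vtx) → (Fin t → Vtx) → Zigzag s t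
                 → Vtx → Vtx → ℕ
    zigzagArrows I O Z u v =
      count (λ j → δ u (I (a j)) * δ v (O (b j)))
      + count (λ j → δ u (O (b (csuc j))) * δ v (I (a j)))
      where open Zigzag Z

  spiderArrows : Vtx → Vtx → ℕ
  spiderArrows u v = circleArrows u v
                   + zigzagArrows inV midV inner u v
                   + zigzagArrows midV outV outer u v

  -- the spider web quiver (2-cycles, which only occur for a circle with
  -- exactly 2 vertices, are removed)
  spiderQuiver : Quiver Vtx
  spiderQuiver = remove2cycles _≟V_ spiderArrows

  τ : Quiver Vtx → Quiver Vtx
  τ = tauSeq _≟V_ n midV

module Submission where

-- Pass from a quiver to its skew-symmetric exchange matrix B, on which mutation
-- is an involution.  The middle circle c of a spider web quiver is an induced
-- oriented n-cycle that is balanced: for every vertex x off the circle the sum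
-- of B (c i) x over the circle vanishes, because every zigzag arrow into the
-- circle is matched by one out of it.  Mutating a balanced oriented cycle on at
-- least three vertices at one of its vertices leaves a balanced oriented cycle
-- on the others.  Hence after μ_{n-2} ⋯ μ_1 the vertices n-1 and n carry no
-- arrow between them and have opposite rows; for such a pair μ_n μ_{n-1} merely
-- swaps the two vertices, which s_{n-1,n} undoes, and μ_1 ⋯ μ_{n-2} then undoes
-- μ_{n-2} ⋯ μ_1.

open import Defs
import Algebra.Properties.AbelianGroup as AbelianGroupProperties
import Algebra.Properties.Semiring.Sum as SemiringSum
open import Data.Bool.Base using (true; false; _∨_; if_then_else_)
open import Data.Bool.Properties using (∨-zeroʳ)
open import Data.Empty using (⊥-elim)
import Data.Fin as Fin
open import Data.Fin.Base using (Fin; zero; suc; toℕ; fromℕ; inject₁)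
import Data.Fin.Properties as Finₚ
open import Data.Fin.Relation.Unary.Top using (view; ‵fromℕ; ‵inject₁)
open import Data.Integer.Base as ℤ using (ℤ; +_; -[1+_]; 0ℤ; _⊖_; -_)
import Data.Integer.Properties as ℤₚ
open import Data.Integer.Tactic.RingSolver using (solve-∀)
open import Data.List.Base using (List; []; _∷_; _++_; _∷ʳ_; map; foldl; reverse; allFin)
import Data.List.Properties as Listₚ
open import Data.Nat.Base using (ℕ; zero; suc; _+_; _*_; _∸_; _<_; s≤s)
import Data.Nat.ListAction as ListAction
import Data.Nat.Properties as ℕₚ
open import Data.Sum.Base using (inj₁; inj₂)
open import Function.Base using (_∘_; id)
open import Relation.Binary.Definitions using (DecidableEquality)
open import Relation.Binary.PropositionalEquality
open import Relation.Nullary using (does; yes; no; contradiction)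
open import Relation.Nullary.Decidable using (dec-true; dec-false; toSum)

open ≡-Reasoning
open AbelianGroupProperties ℤₚ.+-0-abelianGroup using (inverseʳ-unique)

module ℕΣ = SemiringSum ℕₚ.+-*-semiring
module ℤΣ = SemiringSum ℤₚ.+-*-semiring
open ℕΣ using (sum-syntax)

sumℤ : ∀ n → (Fin n → ℤ) → ℤ
sumℤ _ = ℤΣ.sum

syntax sumℤ n (λ i → x) = ∑ℤ[ i < n ] x

[_]⁺ : ℤ → ℕ
[ + n ]⁺      = n
[ -[1+ n ] ]⁺ = 0

[m⊖n]⁺≡m∸n : ∀ m n → [ m ⊖ n ]⁺ ≡ m ∸ n
[m⊖n]⁺≡m∸n m n with ℕₚ.≤-total n m
... | inj₁ n≤m = cong [_]⁺ (ℤₚ.⊖-≥ n≤m)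
... | inj₂ m≤n = begin
  [ m ⊖ n ]⁺        ≡⟨ cong [_]⁺ (ℤₚ.⊖-≤ m≤n) ⟩
  [ - + (n ∸ m) ]⁺  ≡⟨ [-+k]⁺≡0 (n ∸ m) ⟩
  0                 ≡⟨ ℕₚ.m≤n⇒m∸n≡0 m≤n ⟨
  m ∸ n             ∎
  where
  [-+k]⁺≡0 : ∀ k → [ - + k ]⁺ ≡ 0
  [-+k]⁺≡0 zero    = refl
  [-+k]⁺≡0 (suc k) = refl

[x]⁺⊖[-x]⁺≡x : ∀ x → [ x ]⁺ ⊖ [ - x ]⁺ ≡ x
[x]⁺⊖[-x]⁺≡x (+ zero)  = refl
[x]⁺⊖[-x]⁺≡x (+ suc n) = refl
[x]⁺⊖[-x]⁺≡x -[1+ n ]  = refl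

⊖-+-⊖ : ∀ m n p q → (m ⊖ n) ℤ.+ (p ⊖ q) ≡ (m + p) ⊖ (n + q)
⊖-+-⊖ m n p q = begin
  (m ⊖ n) ℤ.+ (p ⊖ q)              ≡⟨ cong₂ ℤ._+_ (ℤₚ.[+m]-[+n]≡m⊖n m n) (ℤₚ.[+m]-[+n]≡m⊖n p q) ⟨
  (+ m ℤ.- + n) ℤ.+ (+ p ℤ.- + q)  ≡⟨ interchange (+ m) (+ n) (+ p) (+ q) ⟩
  (+ m ℤ.+ + p) ℤ.- (+ n ℤ.+ + q)  ≡⟨ cong₂ ℤ._-_ (ℤₚ.pos-+ m p) (ℤₚ.pos-+ n q) ⟨
  + (m + p) ℤ.- + (n + q)          ≡⟨ ℤₚ.[+m]-[+n]≡m⊖n (m + p) (n + q) ⟩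
  (m + p) ⊖ (n + q)                ∎
  where
  interchange : ∀ a b c d → (a ℤ.- b) ℤ.+ (c ℤ.- d) ≡ (a ℤ.+ c) ℤ.- (b ℤ.+ d)
  interchange = solve-∀

+-⊖-cancel : ∀ x m n → x ℤ.+ (m ⊖ n) ℤ.+ (n ⊖ m) ≡ x
+-⊖-cancel x m n = begin
  x ℤ.+ (m ⊖ n) ℤ.+ (n ⊖ m)    ≡⟨ ℤₚ.+-assoc x (m ⊖ n) (n ⊖ m) ⟩
  x ℤ.+ ((m ⊖ n) ℤ.+ (n ⊖ m))  ≡⟨ cong (ℤ._+_ x) (⊖-+-⊖ m n n m) ⟩
  x ℤ.+ ((m + n) ⊖ (n + m))    ≡⟨ cong (λ k → x ℤ.+ ((m + n) ⊖ k)) (ℕₚ.+-comm n m) ⟩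
  x ℤ.+ ((m + n) ⊖ (m + n))    ≡⟨ cong (ℤ._+_ x) (ℤₚ.n⊖n≡0 (m + n)) ⟩
  x ℤ.+ 0ℤ                     ≡⟨ ℤₚ.+-identityʳ x ⟩
  x                            ∎

[x+[m⊖n]]⁺ : ∀ x m n → [ x ℤ.+ (m ⊖ n) ]⁺ ≡ ([ x ]⁺ + m) ∸ ([ - x ]⁺ + n)
[x+[m⊖n]]⁺ x m n = begin
  [ x ℤ.+ (m ⊖ n) ]⁺                        ≡⟨ cong (λ y → [ y ℤ.+ (m ⊖ n) ]⁺) ([x]⁺⊖[-x]⁺≡x x) ⟨
  [ ([ x ]⁺ ⊖ [ - x ]⁺) ℤ.+ (m ⊖ n) ]⁺      ≡⟨ cong [_]⁺ (⊖-+-⊖ [ x ]⁺ [ - x ]⁺ m n) ⟩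
  [ ([ x ]⁺ + m) ⊖ ([ - x ]⁺ + n) ]⁺        ≡⟨ [m⊖n]⁺≡m∸n ([ x ]⁺ + m) ([ - x ]⁺ + n) ⟩
  ([ x ]⁺ + m) ∸ ([ - x ]⁺ + n)             ∎

x≡-x⇒x≡0 : ∀ {x} → x ≡ - x → x ≡ 0ℤ
x≡-x⇒x≡0 {+ zero}   _ = refl
x≡-x⇒x≡0 {+ suc n}  ()
x≡-x⇒x≡0 { -[1+ n ]} ()

∑-⊖ : ∀ {k} (f g : Fin k → ℕ) → ∑ℤ[ i < k ] (f i ⊖ g i) ≡ ∑[ i < k ] f i ⊖ ∑[ i < k ] g i
∑-⊖ {zero}  f g = refl
∑-⊖ {suc k} f g = begin
  (f zero ⊖ g zero) ℤ.+ ∑ℤ[ i < k ] (f (suc i) ⊖ g (suc i))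
    ≡⟨ cong (ℤ._+_ (f zero ⊖ g zero)) (∑-⊖ (f ∘ suc) (g ∘ suc)) ⟩
  (f zero ⊖ g zero) ℤ.+ (∑[ i < k ] f (suc i) ⊖ ∑[ i < k ] g (suc i))
    ≡⟨ ⊖-+-⊖ (f zero) (g zero) (∑[ i < k ] f (suc i)) (∑[ i < k ] g (suc i)) ⟩
  ∑[ i < suc k ] f i ⊖ ∑[ i < suc k ] g i
    ∎

∑-*ʳ-of-∑≡1 : ∀ {k} (f : Fin k → ℕ) p → ∑[ i < k ] f i ≡ 1 → ∑[ i < k ] (f i * p) ≡ p
∑-*ʳ-of-∑≡1 f p ∑f≡1 = begin
  ∑[ i < _ ] (f i * p)  ≡⟨ ℕΣ.*-distribʳ-sum p f ⟨
  ℕΣ.sum f * p          ≡⟨ cong (_* p) ∑f≡1 ⟩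
  1 * p                 ≡⟨ ℕₚ.*-identityˡ p ⟩
  p                     ∎

∑-*ˡ-of-∑≡1 : ∀ {k} (f : Fin k → ℕ) p → ∑[ i < k ] f i ≡ 1 → ∑[ i < k ] (p * f i) ≡ p
∑-*ˡ-of-∑≡1 f p ∑f≡1 = begin
  ∑[ i < _ ] (p * f i)  ≡⟨ ℕΣ.*-distribˡ-sum p f ⟨
  p * ℕΣ.sum f          ≡⟨ cong (p *_) ∑f≡1 ⟩
  p * 1                 ≡⟨ ℕₚ.*-identityʳ p ⟩
  p                     ∎

map-allFin-suc : ∀ {A : Set} {n} (f : Fin (suc n) → A) →
                 map f (allFin (suc n)) ≡ f zero ∷ map (f ∘ suc) (allFin n)
map-allFin-suc f =
  cong (f zero ∷_) (trans (Listₚ.map-tabulate suc f) (sym (Listₚ.map-tabulate id (f ∘ suc))))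

allFin-split : ∀ {A : Set} m (c : Fin (suc (suc m)) → A) →
               map c (allFin (suc (suc m))) ≡
               map (c ∘ inject₁ ∘ inject₁) (allFin m) ++ c (inject₁ (fromℕ m)) ∷ c (fromℕ (suc m)) ∷ []
allFin-split zero    c = refl
allFin-split (suc m) c = begin
  map c (allFin (suc (suc (suc m))))
    ≡⟨ map-allFin-suc c ⟩
  c zero ∷ map (c ∘ suc) (allFin (suc (suc m)))
    ≡⟨ cong (c zero ∷_) (allFin-split m (c ∘ suc)) ⟩
  c zero ∷ map (c ∘ suc ∘ inject₁ ∘ inject₁) (allFin m) ++ lastTwo
    ≡⟨ cong (_++ lastTwo) (map-allFin-suc (c ∘ inject₁ ∘ inject₁)) ⟨
  map (c ∘ inject₁ ∘ inject₁) (allFin (suc m)) ++ lastTwo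
    ∎
  where
  lastTwo : List _
  lastTwo = c (inject₁ (fromℕ (suc m))) ∷ c (fromℕ (suc (suc m))) ∷ []

-- spiderArrows counts zigzag arrows in this form, so its entries unfold to counts.
count : ∀ {k} → (Fin k → ℕ) → ℕ
count {k} f = ListAction.sum (map f (allFin k))

count≡∑ : ∀ {k} (f : Fin k → ℕ) → count f ≡ ∑[ i < k ] f i
count≡∑ {zero}  f = refl
count≡∑ {suc k} f =
  trans (cong ListAction.sum (map-allFin-suc f)) (cong (_+_ (f zero)) (count≡∑ (f ∘ suc)))

count-zero : ∀ k → count {k} (λ _ → 0) ≡ 0
count-zero k = trans (count≡∑ {k} (λ _ → 0)) (ℕΣ.sum-replicate-zero k)

count-*-zero : ∀ {k} (f : Fin k → ℕ) → count (λ i → f i * 0) ≡ 0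
count-*-zero {k} f =
  trans (count≡∑ (λ i → f i * 0)) (trans (ℕΣ.sum-cong-≗ (ℕₚ.*-zeroʳ ∘ f)) (ℕΣ.sum-replicate-zero k))

δ : ∀ {k} → Fin k → Fin k → ℕ
δ i j = if does (i Fin.≟ j) then 1 else 0

∑-δˡ : ∀ {k} (t : Fin k) → ∑[ i < k ] δ i t ≡ 1
∑-δˡ {suc k} zero    = cong suc (ℕΣ.sum-replicate-zero k)
∑-δˡ {suc k} (suc t) = ∑-δˡ t

∑-δʳ : ∀ {k} (t : Fin k) → ∑[ j < k ] δ t j ≡ 1
∑-δʳ {suc k} zero    = cong suc (ℕΣ.sum-replicate-zero k)
∑-δʳ {suc k} (suc t) = ∑-δʳ t

∑-δ-weightedˡ : ∀ {n k} (e : Fin k → Fin n) (w : Fin k → ℕ) →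
                ∑[ i < n ] ∑[ t < k ] (δ i (e t) * w t) ≡ ∑[ t < k ] w t
∑-δ-weightedˡ {n} {k} e w = begin
  ∑[ i < n ] ∑[ t < k ] (δ i (e t) * w t)
    ≡⟨ ℕΣ.∑-comm (λ i t → δ i (e t) * w t) ⟩
  ∑[ t < k ] ∑[ i < n ] (δ i (e t) * w t)
    ≡⟨ ℕΣ.sum-cong-≗ (λ t → ∑-*ʳ-of-∑≡1 (λ i → δ i (e t)) (w t) (∑-δˡ (e t))) ⟩
  ∑[ t < k ] w t
    ∎

∑-δ-weightedʳ : ∀ {n k} (e : Fin k → Fin n) (w : Fin k → ℕ) →
                ∑[ i < n ] ∑[ t < k ] (w t * δ i (e t)) ≡ ∑[ t < k ] w t
∑-δ-weightedʳ e w = trans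
  (ℕΣ.sum-cong-≗ (λ i → ℕΣ.sum-cong-≗ (λ t → ℕₚ.*-comm (w t) (δ i (e t)))))
  (∑-δ-weightedˡ e w)

csuc-inject₁ : ∀ {k} (i : Fin k) → csuc (inject₁ i) ≡ suc i
csuc-inject₁ {k} i with suc (toℕ (inject₁ i)) ℕₚ.<? suc k
... | yes p = Finₚ.toℕ-injective (trans (Finₚ.toℕ-fromℕ< p) (cong suc (Finₚ.toℕ-inject₁ i)))
... | no ¬p = contradiction (s≤s (subst (_< k) (sym (Finₚ.toℕ-inject₁ i)) (Finₚ.toℕ<n i))) ¬p

csuc-fromℕ : ∀ k → csuc (fromℕ k) ≡ zero
csuc-fromℕ k with suc (toℕ (fromℕ k)) ℕₚ.<? suc k
... | yes (s≤s p) = contradiction (subst (_< k) (Finₚ.toℕ-fromℕ k) p) (ℕₚ.<-irrefl refl)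
... | no _        = refl

∑-csuc : ∀ {k} (f : Fin k → ℕ) → ∑[ i < k ] f (csuc i) ≡ ∑[ i < k ] f i
∑-csuc {zero}  f = refl
∑-csuc {suc k} f = begin
  ∑[ i < suc k ] f (csuc i)                             ≡⟨ ℕΣ.sum-init-last (f ∘ csuc) ⟩
  ∑[ i < k ] f (csuc (inject₁ i)) + f (csuc (fromℕ k))  ≡⟨ cong₂ _+_ (ℕΣ.sum-cong-≗ (cong f ∘ csuc-inject₁))
                                                                    (cong f (csuc-fromℕ k)) ⟩
  ∑[ i < k ] f (suc i) + f zero                         ≡⟨ ℕₚ.+-comm _ (f zero) ⟩
  ∑[ i < suc k ] f i                                    ∎

cycleArrows : ∀ {k} → Fin k → Fin k → ℕ
cycleArrows i j = δ (csuc i) j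

cycleArrows-in : ∀ {k} (t : Fin k) → ∑[ i < k ] cycleArrows i t ≡ 1
cycleArrows-in t = trans (∑-csuc (λ i → δ i t)) (∑-δˡ t)

cycleArrows-out : ∀ {k} (t : Fin k) → ∑[ j < k ] cycleArrows t j ≡ 1
cycleArrows-out t = ∑-δʳ (csuc t)

-- On three or more vertices there is no 2-cycle through the vertex 0.
cycleArrows-into-0 : ∀ {r} (i : Fin (suc (suc r))) →
                     cycleArrows (suc i) zero ∸ cycleArrows zero (suc i) ≡ cycleArrows (suc i) zero
cycleArrows-into-0 zero    = refl
cycleArrows-into-0 (suc i) = refl

cycleArrows-from-0 : ∀ {r} (i : Fin (suc (suc r))) →
                     cycleArrows zero (suc i) ∸ cycleArrows (suc i) zero ≡ cycleArrows zero (suc i)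
cycleArrows-from-0 zero    = refl
cycleArrows-from-0 (suc i) = ℕₚ.0∸n≡0 (cycleArrows (suc (suc i)) zero)

-- Mutating the oriented (r+3)-cycle at 0 gives the oriented (r+2)-cycle on
-- the remaining vertices.
cycleArrows-μ : ∀ {r} (i j : Fin (suc (suc r))) →
                cycleArrows i j ≡ cycleArrows (suc i) (suc j) + cycleArrows (suc i) zero * cycleArrows zero (suc j)
cycleArrows-μ {r} i j with view i
... | ‵fromℕ
  rewrite csuc-fromℕ (suc r) | csuc-fromℕ (suc (suc r)) = sym (ℕₚ.+-identityʳ (δ zero j))
... | ‵inject₁ i
  rewrite csuc-inject₁ i | csuc-inject₁ (suc i) = sym (ℕₚ.+-identityʳ (δ (suc i) j))

-- Exchange matrices and their mutation

Matrix : Set → Set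
Matrix V = V → V → ℤ

netArrows : ∀ {V} → Quiver V → Matrix V
netArrows Q i j = Q i j ⊖ Q j i

Skew : ∀ {V} → Matrix V → Set
Skew B = ∀ i j → B j i ≡ - B i j

netArrows-skew : ∀ {V} (Q : Quiver V) → Skew (netArrows Q)
netArrows-skew Q i j = ℤₚ.⊖-swap (Q j i) (Q i j)

skew-diagonal : ∀ {V} {B : Matrix V} → Skew B → ∀ i → B i i ≡ 0ℤ
skew-diagonal skew i = x≡-x⇒x≡0 (skew i i)

module Mutation {V : Set} (_≟_ : DecidableEquality V) where

  infix 4 _≐_
  _≐_ : Matrix V → Matrix V → Set
  B ≐ C = ∀ i j → B i j ≡ C i j

  -- On skew-symmetric matrices this is Fomin–Zelevinsky matrix mutation.
  μ : V → Matrix V → Matrix V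
  μ k B i j =
    if does (i ≟ k) ∨ does (j ≟ k)
    then - B i j
    else B i j ℤ.+ ([ B i k ]⁺ * [ B k j ]⁺ ⊖ [ B j k ]⁺ * [ B k i ]⁺)

  μ-row : ∀ k B j → μ k B k j ≡ - B k j
  μ-row k B j rewrite dec-true (k ≟ k) refl = refl

  μ-col : ∀ k B i → μ k B i k ≡ - B i k
  μ-col k B i rewrite dec-true (k ≟ k) refl | ∨-zeroʳ (does (i ≟ k)) = refl

  μ-off : ∀ k B {i j} → i ≢ k → j ≢ k →
          μ k B i j ≡ B i j ℤ.+ ([ B i k ]⁺ * [ B k j ]⁺ ⊖ [ B j k ]⁺ * [ B k i ]⁺)
  μ-off k B {i} {j} i≢k j≢k rewrite dec-false (i ≟ k) i≢k | dec-false (j ≟ k) j≢k = refl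

  μ-cong : ∀ k {B C} → B ≐ C → μ k B ≐ μ k C
  μ-cong k B≐C i j rewrite B≐C i j | B≐C i k | B≐C k j | B≐C j k | B≐C k i = refl

  μ-skew : ∀ k {B} → Skew B → Skew (μ k B)
  μ-skew k {B} skew i j with toSum (i ≟ k) | toSum (j ≟ k)
  ... | inj₁ refl | _         = trans (μ-col i B j) (cong -_ (trans (skew i j) (sym (μ-row i B j))))
  ... | inj₂ _    | inj₁ refl = trans (μ-row j B i) (cong -_ (trans (skew i j) (sym (μ-col j B i))))
  ... | inj₂ i≢k | inj₂ j≢k = begin
    μ k B j i                                      ≡⟨ μ-off k B j≢k i≢k ⟩
    B j i ℤ.+ (R ⊖ P)                              ≡⟨ cong₂ ℤ._+_ (skew i j) (ℤₚ.⊖-swap R P) ⟩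
    - B i j ℤ.+ - (P ⊖ R)                          ≡⟨ ℤₚ.neg-distrib-+ (B i j) (P ⊖ R) ⟨
    - (B i j ℤ.+ (P ⊖ R))                          ≡⟨ cong -_ (μ-off k B i≢k j≢k) ⟨
    - μ k B i j                                    ∎
    where
    P R : ℕ
    P = [ B i k ]⁺ * [ B k j ]⁺
    R = [ B j k ]⁺ * [ B k i ]⁺

  μ-involutive : ∀ k {B} → Skew B → μ k (μ k B) ≐ B
  μ-involutive k {B} skew i j with toSum (i ≟ k) | toSum (j ≟ k)
  ... | inj₁ refl | _ =
    trans (μ-row i (μ i B) j) (trans (cong -_ (μ-row i B j)) (ℤₚ.neg-involutive (B i j)))
  ... | inj₂ _ | inj₁ refl =
    trans (μ-col j (μ j B) i) (trans (cong -_ (μ-col j B i)) (ℤₚ.neg-involutive (B i j)))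
  ... | inj₂ i≢k | inj₂ j≢k = begin
    μ k (μ k B) i j                                ≡⟨ μ-off k (μ k B) i≢k j≢k ⟩
    μ k B i j ℤ.+ ([ μ k B i k ]⁺ * [ μ k B k j ]⁺ ⊖ [ μ k B j k ]⁺ * [ μ k B k i ]⁺)
      ≡⟨ cong₂ ℤ._+_ (μ-off k B i≢k j≢k) (cong₂ _⊖_ (reversed i j) (reversed j i)) ⟩
    B i j ℤ.+ (P ⊖ R) ℤ.+ (R ⊖ P)                  ≡⟨ +-⊖-cancel (B i j) P R ⟩
    B i j                                          ∎
    where
    P R : ℕ
    P = [ B i k ]⁺ * [ B k j ]⁺
    R = [ B j k ]⁺ * [ B k i ]⁺
    reversed : ∀ x y → [ μ k B x k ]⁺ * [ μ k B k y ]⁺ ≡ [ B y k ]⁺ * [ B k x ]⁺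
    reversed x y = trans
      (cong₂ _*_ (cong [_]⁺ (trans (μ-col k B x) (sym (skew x k))))
                 (cong [_]⁺ (trans (μ-row k B y) (sym (skew k y)))))
      (ℕₚ.*-comm [ B k x ]⁺ [ B y k ]⁺)

  μs : List V → Matrix V → Matrix V
  μs vs B = foldl (λ C v → μ v C) B vs

  μs-cong : ∀ vs {B C} → B ≐ C → μs vs B ≐ μs vs C
  μs-cong []       B≐C = B≐C
  μs-cong (v ∷ vs) B≐C = μs-cong vs (μ-cong v B≐C)

  μs-skew : ∀ vs {B} → Skew B → Skew (μs vs B)
  μs-skew []       skew = skew
  μs-skew (v ∷ vs) skew = μs-skew vs (μ-skew v skew)

  μs-reverse : ∀ vs {B} → Skew B → μs (reverse vs) (μs vs B) ≐ B
  μs-reverse []            skew i j = refl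
  μs-reverse (v ∷ vs) {B} skew i j = begin
    μs (reverse (v ∷ vs)) (μs vs (μ v B)) i j
      ≡⟨ cong (λ ws → μs ws (μs vs (μ v B)) i j) (Listₚ.unfold-reverse v vs) ⟩
    μs (reverse vs ∷ʳ v) (μs vs (μ v B)) i j
      ≡⟨ cong (λ C → C i j) (Listₚ.foldl-∷ʳ (λ C w → μ w C) (μs vs (μ v B)) v (reverse vs)) ⟩
    μ v (μs (reverse vs) (μs vs (μ v B))) i j
      ≡⟨ μ-cong v (μs-reverse vs (μ-skew v skew)) i j ⟩
    μ v (μ v B) i j
      ≡⟨ μ-involutive v skew i j ⟩
    B i j
      ∎

  transposeᴹ : V → V → Matrix V → Matrix V
  transposeᴹ a b B i j = B (swapV _≟_ a b i) (swapV _≟_ a b j)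

  transposeᴹ-skew : ∀ a b {B} → Skew B → Skew (transposeᴹ a b B)
  transposeᴹ-skew a b skew i j = skew (swapV _≟_ a b i) (swapV _≟_ a b j)

  τᴹ : ∀ m → (Fin (suc (suc m)) → V) → Matrix V → Matrix V
  τᴹ m c B =
    μs (reverse (map (c ∘ inject₁ ∘ inject₁) (allFin m)))
       (transposeᴹ (c (inject₁ (fromℕ m))) (c (fromℕ (suc m))) (μs (map c (allFin (suc (suc m)))) B))

  Represents : Quiver V → Matrix V → Set
  Represents Q B = ∀ i j → Q i j ≡ [ B i j ]⁺

  remove2cycles-represents : ∀ Q → Represents (remove2cycles _≟_ Q) (netArrows Q)
  remove2cycles-represents Q i j = sym ([m⊖n]⁺≡m∸n (Q i j) (Q j i))

  mutate-represents : ∀ k {Q B} → Skew B → Represents Q B → Represents (mutate _≟_ k Q) (μ k B)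
  mutate-represents k {Q} {B} skew Q≈B i j with does (i ≟ k) ∨ does (j ≟ k)
  ... | true  = trans (Q≈B j i) (cong [_]⁺ (skew i j))
  ... | false = begin
    (Q i j + Q i k * Q k j) ∸ (Q j i + Q j k * Q k i)
      ≡⟨ cong₂ _∸_ (cong₂ _+_ (Q≈B i j) (cong₂ _*_ (Q≈B i k) (Q≈B k j)))
                   (cong₂ _+_ (trans (Q≈B j i) (cong [_]⁺ (skew i j))) (cong₂ _*_ (Q≈B j k) (Q≈B k i))) ⟩
    ([ B i j ]⁺ + [ B i k ]⁺ * [ B k j ]⁺) ∸ ([ - B i j ]⁺ + [ B j k ]⁺ * [ B k i ]⁺)
      ≡⟨ [x+[m⊖n]]⁺ (B i j) _ _ ⟨
    [ B i j ℤ.+ ([ B i k ]⁺ * [ B k j ]⁺ ⊖ [ B j k ]⁺ * [ B k i ]⁺) ]⁺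
      ∎

  mutateSeq-represents : ∀ vs {Q B} → Skew B → Represents Q B → Represents (mutateSeq _≟_ vs Q) (μs vs B)
  mutateSeq-represents []       skew Q≈B = Q≈B
  mutateSeq-represents (v ∷ vs) skew Q≈B =
    mutateSeq-represents vs (μ-skew v skew) (mutate-represents v skew Q≈B)

  transpose-represents : ∀ a b {Q B} → Represents Q B → Represents (transpose _≟_ a b Q) (transposeᴹ a b B)
  transpose-represents a b Q≈B i j = Q≈B (swapV _≟_ a b i) (swapV _≟_ a b j)

  tauSeq-represents : ∀ m {Q B} (c : Fin (suc (suc m)) → V) → Skew B → Represents Q B →
                      Represents (tauSeq _≟_ (suc (suc m)) c Q) (τᴹ m c B)
  tauSeq-represents m {Q} {B} c skew Q≈B =
    mutateSeq-represents (reverse L) {transpose _≟_ a b (mutateSeq _≟_ all Q)} {transposeᴹ a b (μs all B)}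
      (transposeᴹ-skew a b (μs-skew all skew))
      (transpose-represents a b {mutateSeq _≟_ all Q} {μs all B} (mutateSeq-represents all skew Q≈B))
    where
    L all : List V
    L   = map (c ∘ inject₁ ∘ inject₁) (allFin m)
    all = map c (allFin (suc (suc m)))
    a b : V
    a = c (inject₁ (fromℕ m))
    b = c (fromℕ (suc m))

  -- Opposite pairs

  record Opposite (B : Matrix V) (a b : V) : Set where
    field
      distinct : a ≢ b
      unlinked : B a b ≡ 0ℤ
      opposite : ∀ {x} → x ≢ a → x ≢ b → B b x ≡ - B a x

  data Position (a b x : V) : Set where
    at-a      : x ≡ a → Position a b x
    at-b      : x ≡ b → Position a b x
    elsewhere : x ≢ a → x ≢ b → Position a b x

  position : ∀ a b x → Position a b x
  position a b x with x ≟ a | x ≟ b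
  ... | yes x≡a | _       = at-a x≡a
  ... | no _    | yes x≡b = at-b x≡b
  ... | no x≢a  | no x≢b  = elsewhere x≢a x≢b

  swapV-a : ∀ a b → swapV _≟_ a b a ≡ b
  swapV-a a b rewrite dec-true (a ≟ a) refl = refl

  swapV-b : ∀ {a b} → a ≢ b → swapV _≟_ a b b ≡ a
  swapV-b {a} {b} a≢b rewrite dec-false (b ≟ a) (a≢b ∘ sym) | dec-true (b ≟ b) refl = refl

  swapV-other : ∀ {a b x} → x ≢ a → x ≢ b → swapV _≟_ a b x ≡ x
  swapV-other {a} {b} {x} x≢a x≢b rewrite dec-false (x ≟ a) x≢a | dec-false (x ≟ b) x≢b = refl

  μ-unlinked : ∀ {k l B} → Skew B → B k l ≡ 0ℤ → l ≢ k → ∀ {x} → x ≢ k → μ k B l x ≡ B l x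
  μ-unlinked {k} {l} {B} skew Bkl≡0 l≢k {x} x≢k = begin
    μ k B l x
      ≡⟨ μ-off k B l≢k x≢k ⟩
    B l x ℤ.+ ([ B l k ]⁺ * [ B k x ]⁺ ⊖ [ B x k ]⁺ * [ B k l ]⁺)
      ≡⟨ cong (ℤ._+_ (B l x)) (cong₂ _⊖_ leaving entering) ⟩
    B l x ℤ.+ 0ℤ
      ≡⟨ ℤₚ.+-identityʳ (B l x) ⟩
    B l x
      ∎
    where
    leaving : [ B l k ]⁺ * [ B k x ]⁺ ≡ 0
    leaving = cong (λ y → [ y ]⁺ * [ B k x ]⁺) (trans (skew k l) (cong -_ Bkl≡0))
    entering : [ B x k ]⁺ * [ B k l ]⁺ ≡ 0
    entering = trans (cong (λ y → [ B x k ]⁺ * [ y ]⁺) Bkl≡0) (ℕₚ.*-zeroʳ [ B x k ]⁺)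

  module _ {B : Matrix V} {a b : V} (skew : Skew B) (opp : Opposite B a b) where
    open Opposite opp

    private
      B₁ B₂ T : Matrix V
      B₁ = μ a B
      B₂ = μ b B₁
      T  = transposeᴹ a b B₂

      b≢a : b ≢ a
      b≢a = distinct ∘ sym

      B₁-b-row : ∀ {x} → x ≢ a → B₁ b x ≡ B b x
      B₁-b-row = μ-unlinked skew unlinked b≢a

      B₁-b-col : ∀ {x} → x ≢ a → B₁ x b ≡ B x b
      B₁-b-col {x} x≢a =
        trans (μ-skew a skew b x) (trans (cong -_ (B₁-b-row x≢a)) (sym (skew b x)))

      B₁-ba : B₁ b a ≡ 0ℤ
      B₁-ba = trans (μ-col a B b) (cong -_ (trans (skew a b) (cong -_ unlinked)))

      B-xb : ∀ {x} → x ≢ a → x ≢ b → B x b ≡ B a x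
      B-xb {x} x≢a x≢b =
        trans (skew b x) (trans (cong -_ (opposite x≢a x≢b)) (ℤₚ.neg-involutive (B a x)))

      B-by : ∀ {y} → y ≢ a → y ≢ b → B b y ≡ B y a
      B-by {y} y≢a y≢b = trans (opposite y≢a y≢b) (sym (skew a y))

      -- Row b is minus row a, so the correction made by μ_b cancels that of μ_a.
      B₂-off : ∀ {x y} → x ≢ a → x ≢ b → y ≢ a → y ≢ b → B₂ x y ≡ B x y
      B₂-off {x} {y} x≢a x≢b y≢a y≢b = begin
        B₂ x y
          ≡⟨ μ-off b B₁ x≢b y≢b ⟩
        B₁ x y ℤ.+ ([ B₁ x b ]⁺ * [ B₁ b y ]⁺ ⊖ [ B₁ y b ]⁺ * [ B₁ b x ]⁺)
          ≡⟨ cong₂ ℤ._+_ (μ-off a B x≢a y≢a)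
                         (cong₂ _⊖_ (through-b x≢a x≢b y≢a y≢b) (through-b y≢a y≢b x≢a x≢b)) ⟩
        B x y ℤ.+ (P ⊖ R) ℤ.+ (R ⊖ P)
          ≡⟨ +-⊖-cancel (B x y) P R ⟩
        B x y
          ∎
        where
        P R : ℕ
        P = [ B x a ]⁺ * [ B a y ]⁺
        R = [ B y a ]⁺ * [ B a x ]⁺
        through-b : ∀ {u v} → u ≢ a → u ≢ b → v ≢ a → v ≢ b →
                    [ B₁ u b ]⁺ * [ B₁ b v ]⁺ ≡ [ B v a ]⁺ * [ B a u ]⁺
        through-b {u} {v} u≢a u≢b v≢a v≢b = trans
          (cong₂ (λ p q → [ p ]⁺ * [ q ]⁺) (trans (B₁-b-col u≢a) (B-xb u≢a u≢b))
                                           (trans (B₁-b-row v≢a) (B-by v≢a v≢b)))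
          (ℕₚ.*-comm [ B a u ]⁺ [ B v a ]⁺)

      flip : ∀ {i j} → T j i ≡ B j i → T i j ≡ B i j
      flip {i} {j} Tji≡Bji =
        trans (transposeᴹ-skew a b (μ-skew b (μ-skew a skew)) j i) (trans (cong -_ Tji≡Bji) (sym (skew j i)))

      diagonal : ∀ {i} → T i i ≡ B i i
      diagonal {i} =
        trans (skew-diagonal (transposeᴹ-skew a b (μ-skew b (μ-skew a skew))) i) (sym (skew-diagonal skew i))

      row-a : ∀ j → T a j ≡ B a j
      row-a j with position a b j
      ... | at-a refl = diagonal
      ... | at-b refl = begin
        B₂ (swapV _≟_ a b a) (swapV _≟_ a b b)  ≡⟨ cong₂ B₂ (swapV-a a b) (swapV-b distinct) ⟩
        B₂ b a                                  ≡⟨ μ-row b B₁ a ⟩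
        - B₁ b a                                ≡⟨ cong -_ B₁-ba ⟩
        0ℤ                                      ≡⟨ unlinked ⟨
        B a b                                   ∎
      ... | elsewhere j≢a j≢b = begin
        B₂ (swapV _≟_ a b a) (swapV _≟_ a b j)  ≡⟨ cong₂ B₂ (swapV-a a b) (swapV-other j≢a j≢b) ⟩
        B₂ b j                                  ≡⟨ μ-row b B₁ j ⟩
        - B₁ b j                                ≡⟨ cong -_ (trans (B₁-b-row j≢a) (opposite j≢a j≢b)) ⟩
        - - B a j                               ≡⟨ ℤₚ.neg-involutive (B a j) ⟩
        B a j                                   ∎

      row-b : ∀ j → T b j ≡ B b j
      row-b j with position a b j
      ... | at-a refl = flip (row-a b)
      ... | at-b refl = diagonal
      ... | elsewhere j≢a j≢b = begin
        B₂ (swapV _≟_ a b b) (swapV _≟_ a b j)  ≡⟨ cong₂ B₂ (swapV-b distinct) (swapV-other j≢a j≢b) ⟩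
        B₂ a j                                  ≡⟨ μ-unlinked (μ-skew a skew) B₁-ba distinct j≢b ⟩
        B₁ a j                                  ≡⟨ μ-row a B j ⟩
        - B a j                                 ≡⟨ opposite j≢a j≢b ⟨
        B b j                                   ∎

      row-elsewhere : ∀ {i} → i ≢ a → i ≢ b → ∀ j → T i j ≡ B i j
      row-elsewhere {i} i≢a i≢b j with position a b j
      ... | at-a refl = flip (row-a i)
      ... | at-b refl = flip (row-b i)
      ... | elsewhere j≢a j≢b =
        trans (cong₂ B₂ (swapV-other i≢a i≢b) (swapV-other j≢a j≢b)) (B₂-off i≢a i≢b j≢a j≢b)

    transpose-μ-μ : transposeᴹ a b (μ b (μ a B)) ≐ B
    transpose-μ-μ i j with position a b i
    ... | at-a refl          = row-a j
    ... | at-b refl          = row-b j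
    ... | elsewhere i≢a i≢b  = row-elsewhere i≢a i≢b j

  -- Balanced oriented cycles

  record BalancedCycle (B : Matrix V) {k} (c : Fin k → V) : Set where
    field
      injective : ∀ {i j} → c i ≡ c j → i ≡ j
      induced   : ∀ i j → B (c i) (c j) ≡ cycleArrows i j ⊖ cycleArrows j i
      balanced  : ∀ {x} → (∀ i → x ≢ c i) → ∑ℤ[ i < k ] B (c i) x ≡ 0ℤ

  module _ {r : ℕ} {B : Matrix V} {c : Fin (suc (suc (suc r))) → V}
           (skew : Skew B) (C : BalancedCycle B c) where
    open BalancedCycle C

    private
      c₀ : V
      c₀ = c zero

      B′ : Matrix V
      B′ = μ c₀ B

      tail≢head : ∀ i → c (suc i) ≢ c₀
      tail≢head i ci≡c₀ with injective ci≡c₀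
      ... | ()

      into-head : ∀ i → [ B (c (suc i)) c₀ ]⁺ ≡ cycleArrows (suc i) zero
      into-head i = begin
        [ B (c (suc i)) c₀ ]⁺
          ≡⟨ cong [_]⁺ (induced (suc i) zero) ⟩
        [ cycleArrows (suc i) zero ⊖ cycleArrows zero (suc i) ]⁺
          ≡⟨ [m⊖n]⁺≡m∸n (cycleArrows (suc i) zero) (cycleArrows zero (suc i)) ⟩
        cycleArrows (suc i) zero ∸ cycleArrows zero (suc i)
          ≡⟨ cycleArrows-into-0 i ⟩
        cycleArrows (suc i) zero
          ∎

      from-head : ∀ i → [ B c₀ (c (suc i)) ]⁺ ≡ cycleArrows zero (suc i)
      from-head i = begin
        [ B c₀ (c (suc i)) ]⁺
          ≡⟨ cong [_]⁺ (induced zero (suc i)) ⟩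
        [ cycleArrows zero (suc i) ⊖ cycleArrows (suc i) zero ]⁺
          ≡⟨ [m⊖n]⁺≡m∸n (cycleArrows zero (suc i)) (cycleArrows (suc i) zero) ⟩
        cycleArrows zero (suc i) ∸ cycleArrows (suc i) zero
          ≡⟨ cycleArrows-from-0 i ⟩
        cycleArrows zero (suc i)
          ∎

      induced′ : ∀ i j → B′ (c (suc i)) (c (suc j)) ≡ cycleArrows i j ⊖ cycleArrows j i
      induced′ i j = begin
        B′ (c (suc i)) (c (suc j))
          ≡⟨ μ-off c₀ B (tail≢head i) (tail≢head j) ⟩
        B (c (suc i)) (c (suc j))
          ℤ.+ ([ B (c (suc i)) c₀ ]⁺ * [ B c₀ (c (suc j)) ]⁺ ⊖ [ B (c (suc j)) c₀ ]⁺ * [ B c₀ (c (suc i)) ]⁺)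
          ≡⟨ cong₂ ℤ._+_ (induced (suc i) (suc j))
                         (cong₂ _⊖_ (cong₂ _*_ (into-head i) (from-head j)) (cong₂ _*_ (into-head j) (from-head i))) ⟩
        (A (suc i) (suc j) ⊖ A (suc j) (suc i)) ℤ.+ (A (suc i) zero * A zero (suc j) ⊖ A (suc j) zero * A zero (suc i))
          ≡⟨ ⊖-+-⊖ (A (suc i) (suc j)) (A (suc j) (suc i))
                   (A (suc i) zero * A zero (suc j)) (A (suc j) zero * A zero (suc i)) ⟩
        (A (suc i) (suc j) + A (suc i) zero * A zero (suc j)) ⊖ (A (suc j) (suc i) + A (suc j) zero * A zero (suc i))
          ≡⟨ cong₂ _⊖_ (cycleArrows-μ i j) (cycleArrows-μ j i) ⟨
        cycleArrows i j ⊖ cycleArrows j i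
          ∎
        where
        A : Fin (suc (suc (suc r))) → Fin (suc (suc (suc r))) → ℕ
        A = cycleArrows

      balanced-at-head : ∑ℤ[ i < suc (suc r) ] B′ (c (suc i)) c₀ ≡ 0ℤ
      balanced-at-head = begin
        ∑ℤ[ i < suc (suc r) ] B′ (c (suc i)) c₀
          ≡⟨ ℤΣ.sum-cong-≗ reversed ⟩
        ∑ℤ[ i < suc (suc r) ] (cycleArrows zero (suc i) ⊖ cycleArrows (suc i) zero)
          ≡⟨ ∑-⊖ {suc (suc r)} (λ i → cycleArrows zero (suc i)) (λ i → cycleArrows (suc i) zero) ⟩
        ∑[ i < suc (suc r) ] cycleArrows zero (suc i) ⊖ ∑[ i < suc (suc r) ] cycleArrows (suc i) zero
          ≡⟨ cong₂ _⊖_ (cycleArrows-out {suc (suc (suc r))} zero) (cycleArrows-in {suc (suc (suc r))} zero) ⟩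
        0ℤ
          ∎
        where
        reversed : ∀ i → B′ (c (suc i)) c₀ ≡ cycleArrows zero (suc i) ⊖ cycleArrows (suc i) zero
        reversed i = trans (μ-col c₀ B (c (suc i)))
          (trans (cong -_ (induced (suc i) zero)) (sym (ℤₚ.⊖-swap (cycleArrows zero (suc i)) _)))

      -- Mutation moves the net flow B c₀ x from c₀ onto its two cycle neighbours.
      balanced-off-head : ∀ {x} → x ≢ c₀ → (∀ i → x ≢ c (suc i)) → ∑ℤ[ i < suc (suc r) ] B′ (c (suc i)) x ≡ 0ℤ
      balanced-off-head {x} x≢c₀ x∉ = begin
        ∑ℤ[ i < suc (suc r) ] B′ (c (suc i)) x
          ≡⟨ ℤΣ.sum-cong-≗ (λ i → μ-off c₀ B (tail≢head i) x≢c₀) ⟩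
        ∑ℤ[ i < suc (suc r) ] (B (c (suc i)) x ℤ.+ (entering i ⊖ leaving i))
          ≡⟨ ℤΣ.∑-distrib-+ (λ i → B (c (suc i)) x) (λ i → entering i ⊖ leaving i) ⟩
        Σrest ℤ.+ ∑ℤ[ i < suc (suc r) ] (entering i ⊖ leaving i)
          ≡⟨ cong (ℤ._+_ Σrest) (trans (∑-⊖ entering leaving) (cong₂ _⊖_ ∑-entering ∑-leaving)) ⟩
        Σrest ℤ.+ ([ B c₀ x ]⁺ ⊖ [ B x c₀ ]⁺)
          ≡⟨ cong (ℤ._+_ Σrest) (trans (cong (λ y → [ B c₀ x ]⁺ ⊖ [ y ]⁺) (skew c₀ x)) ([x]⁺⊖[-x]⁺≡x (B c₀ x))) ⟩
        Σrest ℤ.+ B c₀ x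
          ≡⟨ ℤₚ.+-comm Σrest (B c₀ x) ⟩
        ∑ℤ[ i < suc (suc (suc r)) ] B (c i) x
          ≡⟨ balanced x∉c ⟩
        0ℤ
          ∎
        where
        Σrest : ℤ
        Σrest = ∑ℤ[ i < suc (suc r) ] B (c (suc i)) x
        entering leaving : Fin (suc (suc r)) → ℕ
        entering i = [ B (c (suc i)) c₀ ]⁺ * [ B c₀ x ]⁺
        leaving  i = [ B x c₀ ]⁺ * [ B c₀ (c (suc i)) ]⁺
        ∑-entering : ∑[ i < suc (suc r) ] entering i ≡ [ B c₀ x ]⁺
        ∑-entering = trans (ℕΣ.sum-cong-≗ (λ i → cong (_* [ B c₀ x ]⁺) (into-head i)))
          (∑-*ʳ-of-∑≡1 {suc (suc r)} (λ i → cycleArrows (suc i) zero) _ (cycleArrows-in {suc (suc (suc r))} zero))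
        ∑-leaving : ∑[ i < suc (suc r) ] leaving i ≡ [ B x c₀ ]⁺
        ∑-leaving = trans (ℕΣ.sum-cong-≗ (λ i → cong ([ B x c₀ ]⁺ *_) (from-head i)))
          (∑-*ˡ-of-∑≡1 {suc (suc r)} (λ i → cycleArrows zero (suc i)) _ (cycleArrows-out {suc (suc (suc r))} zero))
        x∉c : ∀ i → x ≢ c i
        x∉c zero    = x≢c₀
        x∉c (suc i) = x∉ i

      balanced′ : ∀ {x} → (∀ i → x ≢ c (suc i)) → ∑ℤ[ i < suc (suc r) ] B′ (c (suc i)) x ≡ 0ℤ
      balanced′ {x} x∉ with toSum (x ≟ c₀)
      ... | inj₁ refl = balanced-at-head
      ... | inj₂ x≢c₀ = balanced-off-head x≢c₀ x∉

    BalancedCycle-μ : BalancedCycle (μ (c zero) B) (c ∘ suc)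
    BalancedCycle-μ = record
      { injective = Finₚ.suc-injective ∘ injective
      ; induced   = induced′
      ; balanced  = balanced′
      }

  BalancedCycle₂-opposite : ∀ {B} {c : Fin 2 → V} → BalancedCycle B c → Opposite B (c zero) (c (suc zero))
  BalancedCycle₂-opposite {B} {c} C = record
    { distinct = λ c₀≡c₁ → 0≢1 (injective c₀≡c₁)
    ; unlinked = induced zero (suc zero)
    ; opposite = λ x≢c₀ x≢c₁ → sum-zero (balanced (λ { zero → x≢c₀ ; (suc zero) → x≢c₁ }))
    }
    where
    open BalancedCycle C
    0≢1 : zero ≢ suc zero
    0≢1 ()
    sum-zero : ∀ {x} → B (c zero) x ℤ.+ (B (c (suc zero)) x ℤ.+ 0ℤ) ≡ 0ℤ → B (c (suc zero)) x ≡ - B (c zero) x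
    sum-zero {x} eq = inverseʳ-unique _ _ (trans (cong (ℤ._+_ (B (c zero) x)) (sym (ℤₚ.+-identityʳ _))) eq)

  μs-opposite : ∀ m {B} (c : Fin (suc (suc m)) → V) → Skew B → BalancedCycle B c →
                Opposite (μs (map (c ∘ inject₁ ∘ inject₁) (allFin m)) B) (c (inject₁ (fromℕ m))) (c (fromℕ (suc m)))
  μs-opposite zero    c skew C = BalancedCycle₂-opposite C
  μs-opposite (suc m) {B} c skew C =
    subst (λ vs → Opposite (μs vs B) (c (inject₁ (fromℕ (suc m)))) (c (fromℕ (suc (suc m)))))
          (sym (map-allFin-suc (c ∘ inject₁ ∘ inject₁)))
          (μs-opposite m (c ∘ suc) (μ-skew (c zero) skew) (BalancedCycle-μ skew C))

  τᴹ-balancedCycle : ∀ m {B} (c : Fin (suc (suc m)) → V) → Skew B → BalancedCycle B c → τᴹ m c B ≐ B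
  τᴹ-balancedCycle m {B} c skew C i j = begin
    μs (reverse L) (transposeᴹ a b (μs (map c (allFin (suc (suc m)))) B)) i j
      ≡⟨ cong (λ B′ → μs (reverse L) (transposeᴹ a b B′) i j) split ⟩
    μs (reverse L) (transposeᴹ a b (μ b (μ a (μs L B)))) i j
      ≡⟨ μs-cong (reverse L) (transpose-μ-μ (μs-skew L skew) (μs-opposite m c skew C)) i j ⟩
    μs (reverse L) (μs L B) i j
      ≡⟨ μs-reverse L skew i j ⟩
    B i j
      ∎
    where
    L : List V
    L = map (c ∘ inject₁ ∘ inject₁) (allFin m)
    a b : V
    a = c (inject₁ (fromℕ m))
    b = c (fromℕ (suc m))
    split : μs (map c (allFin (suc (suc m)))) B ≡ μ b (μ a (μs L B))
    split = trans (cong (λ vs → μs vs B) (allFin-split m c)) (Listₚ.foldl-++ (λ C v → μ v C) B L (a ∷ b ∷ []))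

  tauSeq-balancedCycle : ∀ m {Q B} (c : Fin (suc (suc m)) → V) → Skew B → Represents Q B → BalancedCycle B c →
                         ∀ i j → tauSeq _≟_ (suc (suc m)) c Q i j ≡ Q i j
  tauSeq-balancedCycle m {Q} {B} c skew Q≈B C i j = begin
    tauSeq _≟_ (suc (suc m)) c Q i j  ≡⟨ tauSeq-represents m c skew Q≈B i j ⟩
    [ τᴹ m c B i j ]⁺                 ≡⟨ cong [_]⁺ (τᴹ-balancedCycle m c skew C i j) ⟩
    [ B i j ]⁺                        ≡⟨ Q≈B i j ⟨
    Q i j                             ∎

-- The middle circle of a spider web quiver

module _ {m : ℕ} (W : SpiderWeb3 (suc (suc m))) where
  open SpiderWeb3 W
  open Mutation (_≟V_ W)
  private
    module I = Zigzag inner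
    module O = Zigzag outer

    n : ℕ
    n = suc (suc m)

    S : Quiver (Vtx W)
    S = spiderArrows W

  spider-mid-mid : ∀ i j → S (midV W i) (midV W j) ≡ cycleArrows i j
  spider-mid-mid i j = begin
    S (midV W i) (midV W j)
      ≡⟨⟩
    cycleArrows i j + (count {I.k} (λ _ → 0) + count (λ t → δ i (I.b (csuc t)) * 0))
                    + (count (λ t → δ i (O.a t) * 0) + count {O.k} (λ _ → 0))
      ≡⟨ cong₂ (λ u v → cycleArrows i j + u + v)
               (cong₂ _+_ (count-zero I.k) (count-*-zero (λ t → δ i (I.b (csuc t)))))
               (cong₂ _+_ (count-*-zero (λ t → δ i (O.a t))) (count-zero O.k)) ⟩
    cycleArrows i j + 0 + 0
      ≡⟨ trans (ℕₚ.+-identityʳ _) (ℕₚ.+-identityʳ _) ⟩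
    cycleArrows i j
      ∎

  spider-mid-in : ∀ i y → S (midV W i) (inV W y) ≡ ∑[ t < I.k ] (δ i (I.b (csuc t)) * δ y (I.a t))
  spider-mid-in i y = begin
    S (midV W i) (inV W y)
      ≡⟨⟩
    count {I.k} (λ _ → 0) + count (λ t → δ i (I.b (csuc t)) * δ y (I.a t))
      + (count (λ t → δ i (O.a t) * 0) + count {O.k} (λ _ → 0))
      ≡⟨ cong₂ _+_ (cong₂ _+_ (count-zero I.k) (count≡∑ λ t → δ i (I.b (csuc t)) * δ y (I.a t)))
                   (cong₂ _+_ (count-*-zero (λ t → δ i (O.a t))) (count-zero O.k)) ⟩
    ∑[ t < I.k ] (δ i (I.b (csuc t)) * δ y (I.a t)) + 0
      ≡⟨ ℕₚ.+-identityʳ _ ⟩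
    ∑[ t < I.k ] (δ i (I.b (csuc t)) * δ y (I.a t))
      ∎

  spider-in-mid : ∀ i y → S (inV W y) (midV W i) ≡ ∑[ t < I.k ] (δ y (I.a t) * δ i (I.b t))
  spider-in-mid i y = begin
    S (inV W y) (midV W i)
      ≡⟨⟩
    count (λ t → δ y (I.a t) * δ i (I.b t)) + count {I.k} (λ _ → 0)
      + (count {O.k} (λ _ → 0) + count {O.k} (λ _ → 0))
      ≡⟨ cong₂ _+_ (cong₂ _+_ (count≡∑ λ t → δ y (I.a t) * δ i (I.b t)) (count-zero I.k))
                   (cong₂ _+_ (count-zero O.k) (count-zero O.k)) ⟩
    ∑[ t < I.k ] (δ y (I.a t) * δ i (I.b t)) + 0 + 0
      ≡⟨ trans (ℕₚ.+-identityʳ _) (ℕₚ.+-identityʳ _) ⟩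
    ∑[ t < I.k ] (δ y (I.a t) * δ i (I.b t))
      ∎

  spider-mid-out : ∀ i y → S (midV W i) (outV W y) ≡ ∑[ t < O.k ] (δ i (O.a t) * δ y (O.b t))
  spider-mid-out i y = begin
    S (midV W i) (outV W y)
      ≡⟨⟩
    count {I.k} (λ _ → 0) + count (λ t → δ i (I.b (csuc t)) * 0)
      + (count (λ t → δ i (O.a t) * δ y (O.b t)) + count {O.k} (λ _ → 0))
      ≡⟨ cong₂ _+_ (cong₂ _+_ (count-zero I.k) (count-*-zero (λ t → δ i (I.b (csuc t)))))
                   (cong₂ _+_ (count≡∑ λ t → δ i (O.a t) * δ y (O.b t)) (count-zero O.k)) ⟩
    ∑[ t < O.k ] (δ i (O.a t) * δ y (O.b t)) + 0
      ≡⟨ ℕₚ.+-identityʳ _ ⟩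
    ∑[ t < O.k ] (δ i (O.a t) * δ y (O.b t))
      ∎

  spider-out-mid : ∀ i y → S (outV W y) (midV W i) ≡ ∑[ t < O.k ] (δ y (O.b (csuc t)) * δ i (O.a t))
  spider-out-mid i y = begin
    S (outV W y) (midV W i)
      ≡⟨⟩
    count {I.k} (λ _ → 0) + count {I.k} (λ _ → 0)
      + (count {O.k} (λ _ → 0) + count (λ t → δ y (O.b (csuc t)) * δ i (O.a t)))
      ≡⟨ cong₂ _+_ (cong₂ _+_ (count-zero I.k) (count-zero I.k))
                   (cong₂ _+_ (count-zero O.k) (count≡∑ λ t → δ y (O.b (csuc t)) * δ i (O.a t))) ⟩
    ∑[ t < O.k ] (δ y (O.b (csuc t)) * δ i (O.a t))
      ∎

  -- Each index t of a zigzag gives one arrow from the middle circle to its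
  -- vertex on the other circle and one arrow back.
  spider-mid-balanced : ∀ x → (∀ i → x ≢ midV W i) → ∑[ i < n ] S (midV W i) x ≡ ∑[ i < n ] S x (midV W i)
  spider-mid-balanced (inj₁ y) _ = begin
    ∑[ i < n ] S (midV W i) (inV W y)
      ≡⟨ ℕΣ.sum-cong-≗ (λ i → spider-mid-in i y) ⟩
    ∑[ i < n ] ∑[ t < I.k ] (δ i (I.b (csuc t)) * δ y (I.a t))
      ≡⟨ ∑-δ-weightedˡ {n} (I.b ∘ csuc) (λ t → δ y (I.a t)) ⟩
    ∑[ t < I.k ] δ y (I.a t)
      ≡⟨ ∑-δ-weightedʳ {n} I.b (λ t → δ y (I.a t)) ⟨
    ∑[ i < n ] ∑[ t < I.k ] (δ y (I.a t) * δ i (I.b t))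
      ≡⟨ ℕΣ.sum-cong-≗ (λ i → spider-in-mid i y) ⟨
    ∑[ i < n ] S (inV W y) (midV W i)
      ∎
  spider-mid-balanced (inj₂ (inj₁ j)) x∉ = ⊥-elim (x∉ j refl)
  spider-mid-balanced (inj₂ (inj₂ y)) _ = begin
    ∑[ i < n ] S (midV W i) (outV W y)
      ≡⟨ ℕΣ.sum-cong-≗ (λ i → spider-mid-out i y) ⟩
    ∑[ i < n ] ∑[ t < O.k ] (δ i (O.a t) * δ y (O.b t))
      ≡⟨ ∑-δ-weightedˡ {n} O.a (λ t → δ y (O.b t)) ⟩
    ∑[ t < O.k ] δ y (O.b t)
      ≡⟨ ∑-csuc (λ t → δ y (O.b t)) ⟨
    ∑[ t < O.k ] δ y (O.b (csuc t))
      ≡⟨ ∑-δ-weightedʳ {n} O.a (λ t → δ y (O.b (csuc t))) ⟨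
    ∑[ i < n ] ∑[ t < O.k ] (δ y (O.b (csuc t)) * δ i (O.a t))
      ≡⟨ ℕΣ.sum-cong-≗ (λ i → spider-out-mid i y) ⟨
    ∑[ i < n ] S (outV W y) (midV W i)
      ∎

  spider-balancedCycle : BalancedCycle (netArrows S) (midV W)
  spider-balancedCycle = record
    { injective = λ { refl → refl }
    ; induced   = λ i j → cong₂ _⊖_ (spider-mid-mid i j) (spider-mid-mid j i)
    ; balanced  = balanced
    }
    where
    balanced : ∀ {x} → (∀ i → x ≢ midV W i) → ∑ℤ[ i < n ] netArrows S (midV W i) x ≡ 0ℤ
    balanced {x} x∉ = begin
      ∑ℤ[ i < n ] (S (midV W i) x ⊖ S x (midV W i))
        ≡⟨ ∑-⊖ (λ i → S (midV W i) x) (λ i → S x (midV W i)) ⟩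
      ∑[ i < n ] S (midV W i) x ⊖ ∑[ i < n ] S x (midV W i)
        ≡⟨ cong (_⊖ ∑[ i < n ] S x (midV W i)) (spider-mid-balanced x x∉) ⟩
      ∑[ i < n ] S x (midV W i) ⊖ ∑[ i < n ] S x (midV W i)
        ≡⟨ ℤₚ.n⊖n≡0 (∑[ i < n ] S x (midV W i)) ⟩
      0ℤ
        ∎

proposition6p2 : (n : ℕ) (W : SpiderWeb3 n) (u v : Vtx W) →
                 τ W (spiderQuiver W) u v ≡ spiderQuiver W u v
proposition6p2 zero W u v with SpiderWeb3.2≤n W
... | ()
proposition6p2 (suc zero) W u v with SpiderWeb3.2≤n W
... | s≤s ()
proposition6p2 (suc (suc m)) W u v =
  tauSeq-balancedCycle m (midV W) (netArrows-skew (spiderArrows W))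
    (remove2cycles-represents (spiderArrows W)) (spider-balancedCycle W) u v
  where open Mutation (_≟V_ W)
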